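{- Let $f\in\mathbb{Z}[x_1,\ldots,x_n]$ be an irreducible square-free dominated polynomial with positive leading coefficient. Then the following recursive algorithm computes the sets $\min\mathcal{D}_{\geq 0}(f)$ and $\mathcal{D}(f)$. Algorithm (input: $f$; output: $\min\mathcal{D}_{\geq 0}(f)$ and $\mathcal{D}(f)$): (1) Let $\partial_s f=\partial f/\partial x_s$ for all $1\leq s\leq n$. (2) Compute (recursively; for two variables via the explicit formula for $ax_1x_2+b_1x_1+b_2x_2+c$ below) $\tilde{A}_s=\min\mathcal{D}_{\geq 0}(\partial_s f)$ for all $1\leq s\leq n$. (3) Let $A_s=\{\tilde{\mathbf{d}}^{(s)}\mid \tilde{\mathbf{d}}\in\tilde{A}_s\}$. (4) For each $\boldsymbol{\delta}=(\boldsymbol{\delta}_1,\ldots,\boldsymbol{\delta}_n)\in\prod_{s=1}^n A_s$: (5) let $\mathbf{d}=\sup\{\boldsymbol{\delta}_1,\ldots,\boldsymbol{\delta}_n\}$ (entrywise supremum); (6) let $S=\{s\mid \text{the coefficient of } x_s \text{ in } f(X+\mathbf{d}) \text{ is } 0\}$; (7)–(9) if $|S|=0$: for every minimal vector $\mathbf{d}^*$ such that $f(X+\mathbf{d}+\mathbf{d}^*)$ has all non-constant coefficients positive and non-negative constant term, add $\mathbf{d}^*+\mathbf{d}$ to $\min\mathcal{D}_{\geq 0}(f)$; (10)–(14) if $|S|\geq 1$: for each $t\notin S$, let $\mathbf{d}'$ be $\mathbf{d}$ with its $t$-th entry increased by $1$, and for every minimal vector $\mathbf{d}^*$ such that $f(X+\mathbf{d}'+\mathbf{d}^*)$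 has all non-constant coefficients positive and non-negative constant term, add $\mathbf{d}^*+\mathbf{d}'$ to $\min\mathcal{D}_{\geq 0}(f)$; (15)–(19) if $|S|\geq 2$: for each pair $s_1\neq s_2$ in $S$, let $\mathbf{d}'$ be $\mathbf{d}$ with its $s_1$-th and $s_2$-th entries increased by $1$, and add the vectors $\mathbf{d}^*+\mathbf{d}'$ as in the previous step; (20) return $\min\mathcal{D}_{\geq 0}(f)$ and $\mathcal{D}(f)=\{\mathbf{d}\in\min\mathcal{D}_{\geq 0}(f)\mid f(\mathbf{d})=0\}$. Here "add" a vector means: insert it into the set unless it is greater than a vector already in the set, and then delete from the set every vector greater than it.
   Context: A polynomial $f\in\mathbb{Z}[\mathbf{x}]$ is dominated if among its monomials with nonzero coefficient there is one (the dominant monomial) divisible by all of them; here $f$ is square-free with dominant monomial $x_1\cdots x_n$. For $\mathbf{d}\in\mathbb{N}_+^n$ write $f_{\mathbf{d}}(X)=f(X+\mathbf{d})$. A vector $\mathbf{d}\in\mathbb{N}_+^n$ is an arithmetical structure of $f$ if $f(\mathbf{d})=0$ and all non-constant coefficients of $f_{\mathbf{d}}(X)$ are positive; $\mathcal{D}(f)$ is the set of arithmetical structures of $f$. Also $\mathcal{D}_{\geq 0}(f)=\{\mathbf{d}\in\mathbb{N}_+^n\mid$ all non-constant coefficients of $f_{\mathbf{d}}(X)$ are positive and $f(\mathbf{d})\geq 0\}$, and $\min$ denotes the set of minimal elements under the entrywise partial order. For $\mathbf{d}\in\mathbb{Z}^{n-1}$ and $1\leq s\leq n$, $\mathbf{d}^{(s)}\in\mathbb{Z}^n$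 is obtained by inserting the entry $1$ in position $s$ (i.e. $(\mathbf{d}^{(s)})_i=\mathbf{d}_i$ for $i<s$, $=1$ for $i=s$, $=\mathbf{d}_{i-1}$ for $i>s$). Base case: for $f=ax_1x_2+b_1x_1+b_2x_2+c$ with $a\geq 1$, $\min\mathcal{D}_{\geq 0}(f)=\min\{(d,\max(d_2^+,\lceil -(c+b_1d)/(ad+b_2)\rceil))\mid d\in\mathbb{N}_+,\ d_1^+\leq d\leq \max(d_1^+,\lceil -(c+b_2d_2^+)/(ad_2^++b_1)\rceil)\}$, where $d_1^+=\max(1,\lceil (1-b_2)/a\rceil)$ and $d_2^+=\max(1,\lceil (1-b_1)/a\rceil)$. -}

module Defs where

open import Data.Bool using (Bool; true; false; if_then_else_; _∧_)
open import Data.Nat as ℕ using (ℕ; zero; suc; _⊔_)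
import Data.Nat.DivMod as ℕD
open import Data.Integer as ℤ using (ℤ; +_; -[1+_]; +[1+_]; ∣_∣)
open import Data.Fin using (Fin)
open import Data.Fin.Subset using (Subset; ⁅_⁆; ⊤; Nonempty; _∈_; _∉_)
open import Data.Vec using (Vec; []; _∷_; lookup; tabulate; insertAt; updateAt; zipWith; replicate; map)
open import Data.Vec.Relation.Unary.All using (All)
open import Data.Vec.Relation.Binary.Pointwise.Inductive using (Pointwise)
open import Data.List as L using (List)
open import Data.Product using (Σ; ∃; ∃-syntax; _×_; _,_)
open import Data.Sum using (_⊎_)
open import Relation.Binary.PropositionalEquality using (_≡_; _≢_)
open import Relation.Nullary using (¬_)

_≤ᵥ_ : ∀ {k} → Vec ℕ k → Vec ℕ k → Set
_≤ᵥ_ = Pointwise ℕ._≤_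

Min : ∀ {k} → (Vec ℕ k → Set) → Vec ℕ k → Set
Min P v = P v × (∀ w → P w → w ≤ᵥ v → w ≡ v)

Positive : ∀ {k} → Vec ℕ k → Set
Positive = All (ℕ._≤_ 1)

_+ᵥ_ : ∀ {k} → Vec ℕ k → Vec ℕ k → Vec ℕ k
_+ᵥ_ = zipWith ℕ._+_

supᵥ : ∀ {m k} → (Fin m → Vec ℕ k) → Vec ℕ k
supᵥ {m} δ = tabulate λ i → L.foldr _⊔_ 0 (L.map (λ s → lookup (δ s) i) (L.allFin m))

bump : ∀ {k} → Fin k → Vec ℕ k → Vec ℕ k
bump t d = updateAt d t suc

-- d^(s): insert the entry 1 in position s
ins1 : ∀ {k} → Fin (suc k) → Vec ℕ k → Vec ℕ (suc k)
ins1 s d = insertAt d s 1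

-- Square-free polynomials with monomials dividing x₁⋯x_k.
-- A monomial x^T (T ⊆ {1..k}) is a Subset k; the polynomial is its
-- coefficient function.  The dominant monomial is x^⊤ = x₁⋯x_k.

MPoly : ℕ → Set
MPoly k = Subset k → ℤ

allSubsets : (k : ℕ) → List (Subset k)
allSubsets zero = L.[ [] ]
allSubsets (suc k) = L.map (true ∷_) (allSubsets k) L.++ L.map (false ∷_) (allSubsets k)

sumℤ : List ℤ → ℤ
sumℤ = L.foldr ℤ._+_ (+ 0)

monoVal : ∀ {k} → Subset k → Vec ℕ k → ℤ
monoVal [] [] = + 1
monoVal (true ∷ S) (d ∷ ds) = + d ℤ.* monoVal S ds
monoVal (false ∷ S) (d ∷ ds) = monoVal S ds

eval : ∀ {k} → MPoly k → Vec ℕ k → ℤ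
eval {k} f d = sumℤ (L.map (λ S → f S ℤ.* monoVal S d) (allSubsets k))

-- coefficient of x^T in the expansion of ∏_{i∈S} (x_i + d_i)
shiftWeight : ∀ {k} → Subset k → Subset k → Vec ℕ k → ℤ
shiftWeight [] [] [] = + 1
shiftWeight (true  ∷ S) (true  ∷ T) (d ∷ ds) = shiftWeight S T ds
shiftWeight (false ∷ S) (true  ∷ T) (d ∷ ds) = + 0
shiftWeight (true  ∷ S) (false ∷ T) (d ∷ ds) = + d ℤ.* shiftWeight S T ds
shiftWeight (false ∷ S) (false ∷ T) (d ∷ ds) = shiftWeight S T ds

shiftCoeff : ∀ {k} → MPoly k → Vec ℕ k → Subset k → ℤ
shiftCoeff {k} f d T = sumℤ (L.map (λ S → f S ℤ.* shiftWeight S T d) (allSubsets k))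

NonConstPos : ∀ {k} → MPoly k → Vec ℕ k → Set
NonConstPos f d = ∀ T → Nonempty T → ℤ.+ 0 ℤ.< shiftCoeff f d T

Dge0 : ∀ {k} → MPoly k → Vec ℕ k → Set
Dge0 f d = Positive d × NonConstPos f d × (+ 0 ℤ.≤ eval f d)

Dset : ∀ {k} → MPoly k → Vec ℕ k → Set
Dset f d = Positive d × NonConstPos f d × (eval f d ≡ + 0)

-- ∂f/∂x_s, a polynomial in the remaining k variables
∂ : ∀ {k} → Fin (suc k) → MPoly (suc k) → MPoly k
∂ s f T = f (insertAt T s true)

record Poly (k : ℕ) : Set where
  field
    coeff   : Vec ℕ k → ℤ
    bound   : ℕ
    support : ∀ e → coeff e ≢ + 0 → All (λ i → i ℕ.≤ bound) e
open Poly public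

below : ∀ {k} → Vec ℕ k → List (Vec ℕ k)
below [] = L.[ [] ]
below (x ∷ e) = L.concatMap (λ i → L.map (i ∷_) (below e)) (L.upTo (suc x))

mulCoeff : ∀ {k} → Poly k → Poly k → Vec ℕ k → ℤ
mulCoeff g h e = sumℤ (L.map (λ e₁ → coeff g e₁ ℤ.* coeff h (zipWith ℕ._∸_ e e₁)) (below e))

isZeroVec : ∀ {k} → Vec ℕ k → Bool
isZeroVec [] = true
isZeroVec (zero ∷ e) = isZeroVec e
isZeroVec (suc _ ∷ e) = false

oneCoeff : ∀ {k} → Vec ℕ k → ℤ
oneCoeff e = if isZeroVec e then + 1 else + 0

IsUnit : ∀ {k} → Poly k → Set
IsUnit u = ∃[ v ] (∀ e → mulCoeff u v e ≡ oneCoeff e)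

-- exponent vector in {0,1}^k, viewed as a subset (or not)
toSubset? : ∀ {k} → Vec ℕ k → (Subset k → ℤ) → ℤ
toSubset? [] f = f []
toSubset? (zero ∷ e) f = toSubset? e (λ T → f (false ∷ T))
toSubset? (suc zero ∷ e) f = toSubset? e (λ T → f (true ∷ T))
toSubset? (suc (suc _) ∷ e) f = + 0

embed : ∀ {k} → MPoly k → Poly k
embed f = record { coeff = λ e → toSubset? e f ; bound = 1 ; support = sup f }
  where
  sup : ∀ {k} (f : MPoly k) e → toSubset? e f ≢ + 0 → All (λ i → i ℕ.≤ 1) e
  sup f [] _ = All.[]
  sup f (zero ∷ e) ne = ℕ.z≤n All.∷ sup _ e ne
  sup f (suc zero ∷ e) ne = ℕ.s≤s ℕ.z≤n All.∷ sup _ e ne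
  sup f (suc (suc _) ∷ e) ne with ne _≡_.refl
  ... | ()

Irreducible : ∀ {k} → MPoly k → Set
Irreducible {k} f =
  (∃[ e ] toSubset? e f ≢ + 0)
  × ¬ IsUnit (embed f)
  × (∀ g h → (∀ e → mulCoeff g h e ≡ toSubset? e f) → IsUnit g ⊎ IsUnit h)

-- ⌈p / q⌉ for q > 0 (junk value 0 for q ≤ 0, never used)
ceilDiv : ℤ → ℤ → ℤ
ceilDiv (+ m) +[1+ k ] = + ((m ℕ.+ k) ℕD./ suc k)
ceilDiv -[1+ m ] +[1+ k ] = ℤ.- (+ (suc m ℕD./ suc k))
ceilDiv _ _ = + 0

module Base (f : MPoly 2) where
  a b₁ b₂ c : ℤ
  a  = f (true ∷ true ∷ [])
  b₁ = f (true ∷ false ∷ [])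
  b₂ = f (false ∷ true ∷ [])
  c  = f (false ∷ false ∷ [])

  d₁⁺ d₂⁺ : ℤ
  d₁⁺ = (+ 1) ℤ.⊔ ceilDiv (+ 1 ℤ.- b₂) a
  d₂⁺ = (+ 1) ℤ.⊔ ceilDiv (+ 1 ℤ.- b₁) a

  upper : ℤ
  upper = d₁⁺ ℤ.⊔ ceilDiv (ℤ.- (c ℤ.+ b₂ ℤ.* d₂⁺)) (a ℤ.* d₂⁺ ℤ.+ b₁)

  second : ℕ → ℤ
  second d = d₂⁺ ℤ.⊔ ceilDiv (ℤ.- (c ℤ.+ b₁ ℤ.* + d)) (a ℤ.* + d ℤ.+ b₂)

  -- the candidate set { (d, max(d₂⁺, ⌈-(c+b₁d)/(ad+b₂)⌉)) | d ∈ ℕ₊, d₁⁺ ≤ d ≤ upper }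
  -- (the second entry is ≥ d₂⁺ ≥ 1, so ∣_∣ is just the conversion to ℕ)
  Cand : Vec ℕ 2 → Set
  Cand v = ∃[ d ] (1 ℕ.≤ d × d₁⁺ ℤ.≤ + d × + d ℤ.≤ upper
                   × v ≡ d ∷ ∣ second d ∣ ∷ [])

baseMin : MPoly 2 → Vec ℕ 2 → Set
baseMin f = Min (Base.Cand f)

module Step {k : ℕ} (f : MPoly k) where
  GoodShift : Vec ℕ k → Vec ℕ k → Set
  GoodShift d e = NonConstPos f (d +ᵥ e) × (+ 0 ℤ.≤ shiftCoeff f (d +ᵥ e) (replicate k false))

  Added : Vec ℕ k → Vec ℕ k → Set
  Added d v = ∃[ d* ] (Min (GoodShift d) d* × v ≡ d* +ᵥ d)

  Zero : Vec ℕ k → Fin k → Set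
  Zero d s = shiftCoeff f d ⁅ s ⁆ ≡ + 0

  AddedFor : (Fin k → Vec ℕ k) → Vec ℕ k → Set
  AddedFor δ v =
      ((∀ s → ¬ Zero d s) × Added d v)
    ⊎ ((∃[ s ] Zero d s) × ∃[ t ] (¬ Zero d t × Added (bump t d) v))
    ⊎ (∃[ s₁ ] ∃[ s₂ ] (s₁ ≢ s₂ × Zero d s₁ × Zero d s₂ × Added (bump s₂ (bump s₁ d)) v))
    where d = supᵥ δ

algMin : (n : ℕ) → MPoly (suc (suc n)) → Vec ℕ (suc (suc n)) → Set
algMin zero f = baseMin f
algMin (suc n) f = Min AllAdded
  where
  k = suc (suc (suc n))
  A : Fin k → Vec ℕ k → Set
  A s v = ∃[ d̃ ] (algMin n (∂ s f) d̃ × v ≡ ins1 s d̃)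
  -- everything added over all δ ∈ ∏ A_s; the result of the successive
  -- "add" operations is the set of minimal elements of this set
  AllAdded : Vec ℕ k → Set
  AllAdded v = ∃[ δ ] ((∀ s → A s (δ s)) × Step.AddedFor f δ v)

algD : (n : ℕ) → MPoly (suc (suc n)) → Vec ℕ (suc (suc n)) → Set
algD n f v = algMin n f v × eval f v ≡ + 0

-- The coefficients of f_d are c_T(d) = Σ_{S ⊇ T} f_S d^(S∖T), and Taylor expansion reads
-- f(w + e) = Σ_T c_T(w) e^T. Above a point w of 𝒟≥0(f) every term is nonnegative and the term of
-- a coordinate that actually increases is positive, so f(v) > 0 for all v > w: the points of 𝒟(f)
-- are exactly the zeros among the minimal points of 𝒟≥0(f).
--
-- The coefficient of x_s x^T in f_d is the coefficient of x^T in (∂ₛf) at d with entry s deleted.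
-- Hence a minimal m ∈ 𝒟≥0(f) lies above d̃^(s) for a minimal d̃ ∈ 𝒟≥0(∂ₛf), for every s, and so
-- above d = sup δ. If no linear coefficient of f_d vanishes, m − d is a minimal admissible shift
-- of d. If the coefficient of x_s vanishes, then m ≠ d; as that coefficient does not involve d_s,
-- m even exceeds d in some coordinate t ≠ s. Bumping t, or, when the coefficient of x_t vanishes
-- too, t and a further coordinate where m exceeds d, stays below m. Conversely every vector the
-- algorithm adds lies in 𝒟≥0(f), because d is positive (δ_s has entry 1 at s). A set inside
-- 𝒟≥0(f) that contains its minimal points has the same minimal points, which gives both outputs.
--
-- For two variables, (x, y) ∈ 𝒟≥0(f) iff d₁⁺ ≤ x and max(d₂⁺, ⌈−(c + b₁x)/(ax + b₂)⌉) ≤ y, and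
-- the corner (upper, d₂⁺) lies in 𝒟≥0(f), which bounds the first entry of minimal points.

{-# OPTIONS --safe #-}
module Submission where

open import Defs
open import Data.Bool using (Bool; true; false)
open import Data.Empty using (⊥-elim)
open import Data.Fin using (Fin; zero; suc)
import Data.Fin.Properties as Finₚ
open import Data.Fin.Subset using (Subset; ⁅_⁆; ⊤; ⊥; Nonempty)
open import Data.Fin.Subset.Properties using (anySubset?; nonempty?; Empty-unique; x∈⁅x⁆)
open import Data.Integer as ℤ using (ℤ; +_; -[1+_]; +[1+_]; +≤+; +<+; ∣_∣; _+_; _*_; -_; _-_; _≤_; _<_)
import Data.Integer.Properties as ℤₚ
import Algebra.Properties.CommutativeSemigroup as CommutativeSemigroupProperties
open CommutativeSemigroupProperties ℤₚ.+-commutativeSemigroup using (interchange)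
open CommutativeSemigroupProperties ℤₚ.*-commutativeSemigroup using (x∙yz≈y∙xz)
open import Data.Integer.Tactic.RingSolver using (solve-∀)
open import Data.List as List using (List; []; _∷_)
open import Data.List.Membership.Propositional using () renaming (_∈_ to _∈ₗ_)
open import Data.List.Membership.Propositional.Properties using (∈-map⁺; ∈-++⁺ˡ; ∈-++⁺ʳ; ∈-allFin)
open import Data.List.Relation.Unary.Any using (here; there)
open import Data.Nat as ℕ using (ℕ; zero; suc; z≤n; s≤s; _⊔_)
open import Data.Nat.DivMod using (_/_; _%_; m≡m%n+[m/n]*n; m%n<n; m/n*n≤m; m<n*o⇒m/o<n; m*n/n≡m; /-monoˡ-≤)
import Data.Nat.Properties as ℕₚ
open import Data.Product using (∃-syntax; _×_; _,_; proj₁; proj₂)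
open import Data.Product.Function.NonDependent.Propositional using (_×-⇔_)
open import Data.Sum using (inj₁; inj₂)
open import Data.Vec as Vec using (Vec; []; _∷_; lookup; insertAt; zipWith)
import Data.Vec.Properties as Vecₚ
import Data.Vec.Relation.Unary.All as All
import Data.Vec.Relation.Unary.All.Properties as Allₚ
import Data.Vec.Relation.Binary.Pointwise.Inductive as Pointwise
open Pointwise using ([]; _∷_)
open import Data.Vec.Relation.Binary.Pointwise.Extensional using (ext; extensional⇒inductive)
open import Function.Base using (_∘_)
open import Function.Bundles using (_⇔_; mk⇔; Equivalence)
import Function.Properties.Equivalence as ⇔
open import Relation.Binary.PropositionalEquality
open import Relation.Nullary using (Dec; yes; no; ¬?; contradiction)
open import Relation.Nullary.Decidable using (map′; decidable-stable; _×-dec_; _→-dec_)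
open import Relation.Unary using (Decidable)
open import Induction.WellFounded using (Acc; acc)
open import Data.Nat.Induction using (<-wellFounded)

private
  variable
    A B : Set
    k : ℕ

-- Finite sums

∑ : (A → ℤ) → List A → ℤ
∑ g xs = sumℤ (List.map g xs)

∑-++ : ∀ (g : A → ℤ) xs ys → ∑ g (xs List.++ ys) ≡ ∑ g xs + ∑ g ys
∑-++ g [] ys = sym (ℤₚ.+-identityˡ _)
∑-++ g (x ∷ xs) ys = trans (cong (λ z → g x + z) (∑-++ g xs ys)) (sym (ℤₚ.+-assoc (g x) _ _))

∑-map : ∀ (g : B → ℤ) (h : A → B) xs → ∑ g (List.map h xs) ≡ ∑ (g ∘ h) xs
∑-map g h [] = refl
∑-map g h (x ∷ xs) = cong (λ z → g (h x) + z) (∑-map g h xs)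

∑-cong : ∀ {g h : A → ℤ} → (∀ x → g x ≡ h x) → ∀ xs → ∑ g xs ≡ ∑ h xs
∑-cong g≗h [] = refl
∑-cong g≗h (x ∷ xs) = cong₂ ℤ._+_ (g≗h x) (∑-cong g≗h xs)

∑-zero : ∀ (xs : List A) → ∑ (λ _ → + 0) xs ≡ + 0
∑-zero [] = refl
∑-zero (x ∷ xs) = trans (ℤₚ.+-identityˡ _) (∑-zero xs)

∑-+ : ∀ (g h : A → ℤ) xs → ∑ (λ x → g x + h x) xs ≡ ∑ g xs + ∑ h xs
∑-+ g h [] = refl
∑-+ g h (x ∷ xs) = trans (cong (λ z → g x + h x + z) (∑-+ g h xs)) (interchange (g x) (h x) _ _)

∑-*ˡ : ∀ c (g : A → ℤ) xs → ∑ (λ x → c * g x) xs ≡ c * ∑ g xs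
∑-*ˡ c g [] = sym (ℤₚ.*-zeroʳ c)
∑-*ˡ c g (x ∷ xs) = trans (cong (λ z → c * g x + z) (∑-*ˡ c g xs)) (sym (ℤₚ.*-distribˡ-+ c _ _))

∑-comm : ∀ (g : A → B → ℤ) xs ys →
         ∑ (λ x → ∑ (g x) ys) xs ≡ ∑ (λ y → ∑ (λ x → g x y) xs) ys
∑-comm g [] ys = sym (∑-zero ys)
∑-comm g (x ∷ xs) ys =
  trans (cong (λ z → ∑ (g x) ys + z) (∑-comm g xs ys)) (sym (∑-+ (g x) _ ys))

∑-nonNeg : ∀ {g : A → ℤ} → (∀ x → + 0 ≤ g x) → ∀ xs → + 0 ≤ ∑ g xs
∑-nonNeg g≥0 [] = ℤₚ.≤-refl
∑-nonNeg g≥0 (x ∷ xs) = ℤₚ.+-mono-≤ (g≥0 x) (∑-nonNeg g≥0 xs)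

∑-pos : ∀ {g : A → ℤ} → (∀ x → + 0 ≤ g x) → ∀ {y} xs → y ∈ₗ xs → + 0 < g y → + 0 < ∑ g xs
∑-pos g≥0 (x ∷ xs) (here refl) gy>0 = ℤₚ.+-mono-<-≤ gy>0 (∑-nonNeg g≥0 xs)
∑-pos g≥0 (x ∷ xs) (there y∈xs) gy>0 = ℤₚ.+-mono-≤-< (g≥0 x) (∑-pos g≥0 xs y∈xs gy>0)

Σ[⊆] : (Subset k → ℤ) → ℤ
Σ[⊆] {k} g = ∑ g (allSubsets k)

∈-allSubsets : ∀ (T : Subset k) → T ∈ₗ allSubsets k
∈-allSubsets [] = here refl
∈-allSubsets {suc k} (true ∷ T) = ∈-++⁺ˡ (∈-map⁺ (true ∷_) (∈-allSubsets T))
∈-allSubsets {suc k} (false ∷ T) =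
  ∈-++⁺ʳ (List.map (true ∷_) (allSubsets k)) (∈-map⁺ (false ∷_) (∈-allSubsets T))

Σ[⊆]-cong : ∀ {g h : Subset k → ℤ} → (∀ S → g S ≡ h S) → Σ[⊆] g ≡ Σ[⊆] h
Σ[⊆]-cong {k} g≗h = ∑-cong g≗h (allSubsets k)

Σ[⊆]-*ˡ : ∀ c (g : Subset k → ℤ) → Σ[⊆] (λ S → c * g S) ≡ c * Σ[⊆] g
Σ[⊆]-*ˡ {k} c g = ∑-*ˡ c g (allSubsets k)

Σ[⊆]-∷ : ∀ (g : Subset (suc k) → ℤ) →
         Σ[⊆] g ≡ Σ[⊆] (λ S → g (true ∷ S)) + Σ[⊆] (λ S → g (false ∷ S))
Σ[⊆]-∷ {k} g = trans (∑-++ g (List.map (true ∷_) (allSubsets k)) _)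
  (cong₂ ℤ._+_ (∑-map g (true ∷_) (allSubsets k)) (∑-map g (false ∷_) (allSubsets k)))

Σ[⊆]-insertAt : ∀ (s : Fin (suc k)) (g : Subset (suc k) → ℤ) →
  Σ[⊆] g ≡ Σ[⊆] (λ S → g (insertAt S s true)) + Σ[⊆] (λ S → g (insertAt S s false))
Σ[⊆]-insertAt zero g = Σ[⊆]-∷ g
Σ[⊆]-insertAt {suc k} (suc s) g = begin
  Σ[⊆] g
    ≡⟨ Σ[⊆]-∷ g ⟩
  Σ[⊆] (g ∘ (true ∷_)) + Σ[⊆] (g ∘ (false ∷_))
    ≡⟨ cong₂ _+_ (Σ[⊆]-insertAt s (g ∘ (true ∷_))) (Σ[⊆]-insertAt s (g ∘ (false ∷_))) ⟩
  (part true true + part true false) + (part false true + part false false)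
    ≡⟨ interchange (part true true) (part true false) (part false true) (part false false) ⟩
  (part true true + part false true) + (part true false + part false false)
    ≡⟨ sym (cong₂ _+_ (Σ[⊆]-∷ (λ S → g (insertAt S (suc s) true)))
                      (Σ[⊆]-∷ (λ S → g (insertAt S (suc s) false)))) ⟩
  Σ[⊆] (λ S → g (insertAt S (suc s) true)) + Σ[⊆] (λ S → g (insertAt S (suc s) false)) ∎
  where
  open ≡-Reasoning
  part : Bool → Bool → ℤ
  part b b′ = Σ[⊆] (λ S → g (b ∷ insertAt S s b′))

-- Coefficients of the shifted polynomial

shiftWeight-insertAt-inside : ∀ (s : Fin (suc k)) S T d x →
  shiftWeight (insertAt S s true) (insertAt T s true) (insertAt d s x) ≡ shiftWeight S T d
shiftWeight-insertAt-inside zero S T d x = refl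
shiftWeight-insertAt-inside (suc s) (true ∷ S) (true ∷ T) (y ∷ d) x = shiftWeight-insertAt-inside s S T d x
shiftWeight-insertAt-inside (suc s) (true ∷ S) (false ∷ T) (y ∷ d) x =
  cong (+ y *_) (shiftWeight-insertAt-inside s S T d x)
shiftWeight-insertAt-inside (suc s) (false ∷ S) (true ∷ T) (y ∷ d) x = refl
shiftWeight-insertAt-inside (suc s) (false ∷ S) (false ∷ T) (y ∷ d) x = shiftWeight-insertAt-inside s S T d x

shiftWeight-insertAt-outside : ∀ (s : Fin (suc k)) S T d x →
  shiftWeight (insertAt S s false) (insertAt T s true) (insertAt d s x) ≡ + 0
shiftWeight-insertAt-outside zero S T d x = refl
shiftWeight-insertAt-outside (suc s) (true ∷ S) (true ∷ T) (y ∷ d) x = shiftWeight-insertAt-outside s S T d x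
shiftWeight-insertAt-outside (suc s) (true ∷ S) (false ∷ T) (y ∷ d) x =
  trans (cong (+ y *_) (shiftWeight-insertAt-outside s S T d x)) (ℤₚ.*-zeroʳ (+ y))
shiftWeight-insertAt-outside (suc s) (false ∷ S) (true ∷ T) (y ∷ d) x = refl
shiftWeight-insertAt-outside (suc s) (false ∷ S) (false ∷ T) (y ∷ d) x = shiftWeight-insertAt-outside s S T d x

shiftCoeff-∂ : ∀ (s : Fin (suc k)) f d x T →
  shiftCoeff f (insertAt d s x) (insertAt T s true) ≡ shiftCoeff (∂ s f) d T
shiftCoeff-∂ {k} s f d x T = begin
  shiftCoeff f (insertAt d s x) (insertAt T s true)
    ≡⟨ Σ[⊆]-insertAt s _ ⟩
  Σ[⊆] (λ S → ∂ s f S * shiftWeight (insertAt S s true) (insertAt T s true) (insertAt d s x)) +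
  Σ[⊆] (λ S → f (insertAt S s false) * shiftWeight (insertAt S s false) (insertAt T s true) (insertAt d s x))
    ≡⟨ cong₂ _+_ (Σ[⊆]-cong (λ S → cong (∂ s f S *_) (shiftWeight-insertAt-inside s S T d x)))
                 (trans (Σ[⊆]-cong vanish) (∑-zero (allSubsets k))) ⟩
  shiftCoeff (∂ s f) d T + + 0
    ≡⟨ ℤₚ.+-identityʳ _ ⟩
  shiftCoeff (∂ s f) d T ∎
  where
  open ≡-Reasoning
  vanish : ∀ S →
    f (insertAt S s false) * shiftWeight (insertAt S s false) (insertAt T s true) (insertAt d s x) ≡ + 0
  vanish S = trans (cong (f (insertAt S s false) *_) (shiftWeight-insertAt-outside s S T d x))
                   (ℤₚ.*-zeroʳ (f (insertAt S s false)))

monoVal≡shiftWeight-⊥ : ∀ (S : Subset k) d → monoVal S d ≡ shiftWeight S ⊥ d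
monoVal≡shiftWeight-⊥ [] [] = refl
monoVal≡shiftWeight-⊥ (true ∷ S) (x ∷ d) = cong (+ x *_) (monoVal≡shiftWeight-⊥ S d)
monoVal≡shiftWeight-⊥ (false ∷ S) (x ∷ d) = monoVal≡shiftWeight-⊥ S d

eval≡shiftCoeff-⊥ : ∀ (f : MPoly k) d → eval f d ≡ shiftCoeff f d ⊥
eval≡shiftCoeff-⊥ f d = Σ[⊆]-cong (λ S → cong (f S *_) (monoVal≡shiftWeight-⊥ S d))

shiftWeight-cong : ∀ (S T : Subset k) {d d′} →
  (∀ i → lookup T i ≡ false → lookup d i ≡ lookup d′ i) → shiftWeight S T d ≡ shiftWeight S T d′
shiftWeight-cong [] [] {[]} {[]} _ = refl
shiftWeight-cong (true ∷ S) (true ∷ T) {_ ∷ _} {_ ∷ _} d≗d′ = shiftWeight-cong S T (d≗d′ ∘ suc)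
shiftWeight-cong (false ∷ S) (true ∷ T) {_ ∷ _} {_ ∷ _} d≗d′ = refl
shiftWeight-cong (true ∷ S) (false ∷ T) {_ ∷ _} {_ ∷ _} d≗d′ =
  cong₂ (λ x w → + x * w) (d≗d′ zero refl) (shiftWeight-cong S T (d≗d′ ∘ suc))
shiftWeight-cong (false ∷ S) (false ∷ T) {_ ∷ _} {_ ∷ _} d≗d′ = shiftWeight-cong S T (d≗d′ ∘ suc)

shiftCoeff-cong : ∀ (f : MPoly k) T {d d′} →
  (∀ i → lookup T i ≡ false → lookup d i ≡ lookup d′ i) → shiftCoeff f d T ≡ shiftCoeff f d′ T
shiftCoeff-cong f T d≗d′ = Σ[⊆]-cong (λ S → cong (f S *_) (shiftWeight-cong S T d≗d′))

monoVal-+ᵥ : ∀ (S : Subset k) w e → monoVal S (w +ᵥ e) ≡ Σ[⊆] (λ T → shiftWeight S T w * monoVal T e)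
monoVal-+ᵥ [] [] [] = refl
monoVal-+ᵥ {suc k} (true ∷ S) (x ∷ w) (y ∷ e) = begin
  (+ x + + y) * monoVal S (w +ᵥ e)
    ≡⟨ cong ((+ x + + y) *_) (monoVal-+ᵥ S w e) ⟩
  (+ x + + y) * Σ
    ≡⟨ ℤₚ.*-distribʳ-+ Σ (+ x) (+ y) ⟩
  + x * Σ + + y * Σ
    ≡⟨ ℤₚ.+-comm (+ x * Σ) (+ y * Σ) ⟩
  + y * Σ + + x * Σ
    ≡⟨ sym (cong₂ _+_ (trans (Σ[⊆]-cong (λ T → x∙yz≈y∙xz (shiftWeight S T w) (+ y) _)) (Σ[⊆]-*ˡ (+ y) Σ-term))
                      (trans (Σ[⊆]-cong (λ T → ℤₚ.*-assoc (+ x) (shiftWeight S T w) _)) (Σ[⊆]-*ˡ (+ x) Σ-term))) ⟩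
  Σ[⊆] (λ T → shiftWeight (true ∷ S) (true ∷ T) (x ∷ w) * monoVal (true ∷ T) (y ∷ e)) +
  Σ[⊆] (λ T → shiftWeight (true ∷ S) (false ∷ T) (x ∷ w) * monoVal (false ∷ T) (y ∷ e))
    ≡⟨ sym (Σ[⊆]-∷ (λ T → shiftWeight (true ∷ S) T (x ∷ w) * monoVal T (y ∷ e))) ⟩
  Σ[⊆] (λ T → shiftWeight (true ∷ S) T (x ∷ w) * monoVal T (y ∷ e)) ∎
  where
  open ≡-Reasoning
  Σ-term : Subset k → ℤ
  Σ-term T = shiftWeight S T w * monoVal T e
  Σ : ℤ
  Σ = Σ[⊆] Σ-term
monoVal-+ᵥ {suc k} (false ∷ S) (x ∷ w) (y ∷ e) = begin
  monoVal S (w +ᵥ e)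
    ≡⟨ monoVal-+ᵥ S w e ⟩
  Σ[⊆] (λ T → shiftWeight S T w * monoVal T e)
    ≡⟨ sym (trans (cong (_+ Σ[⊆] (λ T → shiftWeight S T w * monoVal T e)) (∑-zero (allSubsets k)))
                  (ℤₚ.+-identityˡ _)) ⟩
  Σ[⊆] (λ T → shiftWeight (false ∷ S) (true ∷ T) (x ∷ w) * monoVal (true ∷ T) (y ∷ e)) +
  Σ[⊆] (λ T → shiftWeight (false ∷ S) (false ∷ T) (x ∷ w) * monoVal (false ∷ T) (y ∷ e))
    ≡⟨ sym (Σ[⊆]-∷ (λ T → shiftWeight (false ∷ S) T (x ∷ w) * monoVal T (y ∷ e))) ⟩
  Σ[⊆] (λ T → shiftWeight (false ∷ S) T (x ∷ w) * monoVal T (y ∷ e)) ∎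
  where open ≡-Reasoning

eval-+ᵥ : ∀ (f : MPoly k) w e → eval f (w +ᵥ e) ≡ Σ[⊆] (λ T → shiftCoeff f w T * monoVal T e)
eval-+ᵥ {k} f w e = begin
  Σ[⊆] (λ S → f S * monoVal S (w +ᵥ e))
    ≡⟨ Σ[⊆]-cong (λ S → trans (cong (f S *_) (monoVal-+ᵥ S w e)) (sym (Σ[⊆]-*ˡ (f S) (λ T → shiftWeight S T w * monoVal T e)))) ⟩
  Σ[⊆] (λ S → Σ[⊆] (λ T → f S * (shiftWeight S T w * monoVal T e)))
    ≡⟨ ∑-comm (λ S T → f S * (shiftWeight S T w * monoVal T e)) (allSubsets k) (allSubsets k) ⟩
  Σ[⊆] (λ T → Σ[⊆] (λ S → f S * (shiftWeight S T w * monoVal T e)))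
    ≡⟨ Σ[⊆]-cong (λ T → trans (Σ[⊆]-cong (λ S → sym (ℤₚ.*-assoc (f S) _ _)))
                        (trans (Σ[⊆]-cong (λ S → ℤₚ.*-comm (f S * shiftWeight S T w) _))
                        (trans (Σ[⊆]-*ˡ (monoVal T e) (λ S → f S * shiftWeight S T w)) (ℤₚ.*-comm (monoVal T e) _)))) ⟩
  Σ[⊆] (λ T → shiftCoeff f w T * monoVal T e) ∎
  where open ≡-Reasoning

-- The entrywise order and minimal elements

≤ᵥ-refl : ∀ {v : Vec ℕ k} → v ≤ᵥ v
≤ᵥ-refl = Pointwise.refl ℕₚ.≤-refl

≤ᵥ-reflexive : ∀ {u v : Vec ℕ k} → u ≡ v → u ≤ᵥ v
≤ᵥ-reflexive refl = ≤ᵥ-refl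

≤ᵥ-trans : ∀ {u v w : Vec ℕ k} → u ≤ᵥ v → v ≤ᵥ w → u ≤ᵥ w
≤ᵥ-trans = Pointwise.trans ℕₚ.≤-trans

≤ᵥ-antisym : ∀ {u v : Vec ℕ k} → u ≤ᵥ v → v ≤ᵥ u → u ≡ v
≤ᵥ-antisym [] [] = refl
≤ᵥ-antisym (p ∷ ps) (q ∷ qs) = cong₂ _∷_ (ℕₚ.≤-antisym p q) (≤ᵥ-antisym ps qs)

lookup⁻¹-≤ᵥ : ∀ {u v : Vec ℕ k} → (∀ i → lookup u i ℕ.≤ lookup v i) → u ≤ᵥ v
lookup⁻¹-≤ᵥ u≤v = extensional⇒inductive (ext u≤v)

≤ᵥ∧≢⇒∃< : ∀ {u v : Vec ℕ k} → u ≤ᵥ v → u ≢ v → ∃[ i ] lookup u i ℕ.< lookup v i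
≤ᵥ∧≢⇒∃< {u = []} {[]} [] u≢v = contradiction refl u≢v
≤ᵥ∧≢⇒∃< {u = x ∷ u} (p ∷ ps) u≢v with ℕₚ.m≤n⇒m<n∨m≡n p
... | inj₁ x<y = zero , x<y
... | inj₂ refl = let i , lt = ≤ᵥ∧≢⇒∃< ps (u≢v ∘ cong (x ∷_)) in suc i , lt

Positive-mono : ∀ {u v : Vec ℕ k} → u ≤ᵥ v → Positive u → Positive v
Positive-mono [] All.[] = All.[]
Positive-mono (p ∷ ps) (q All.∷ qs) = ℕₚ.≤-trans q p All.∷ Positive-mono ps qs

_∸ᵥ_ : Vec ℕ k → Vec ℕ k → Vec ℕ k
_∸ᵥ_ = zipWith ℕ._∸_

+ᵥ-comm : ∀ (u v : Vec ℕ k) → u +ᵥ v ≡ v +ᵥ u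
+ᵥ-comm u v = Pointwise.Pointwise-≡⇒≡ (Pointwise.zipWith-comm ℕₚ.+-comm u v)

u+ᵥ[v∸ᵥu]≡v : ∀ {u v : Vec ℕ k} → u ≤ᵥ v → u +ᵥ (v ∸ᵥ u) ≡ v
u+ᵥ[v∸ᵥu]≡v [] = refl
u+ᵥ[v∸ᵥu]≡v (p ∷ ps) = cong₂ _∷_ (ℕₚ.m+[n∸m]≡n p) (u+ᵥ[v∸ᵥu]≡v ps)

u≤ᵥu+ᵥv : ∀ (u v : Vec ℕ k) → u ≤ᵥ (u +ᵥ v)
u≤ᵥu+ᵥv [] [] = []
u≤ᵥu+ᵥv (x ∷ u) (y ∷ v) = ℕₚ.m≤m+n x y ∷ u≤ᵥu+ᵥv u v

+ᵥ-monoʳ-≤ᵥ : ∀ (u : Vec ℕ k) {v w} → v ≤ᵥ w → (u +ᵥ v) ≤ᵥ (u +ᵥ w)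
+ᵥ-monoʳ-≤ᵥ [] [] = []
+ᵥ-monoʳ-≤ᵥ (x ∷ u) (p ∷ ps) = ℕₚ.+-monoʳ-≤ x p ∷ +ᵥ-monoʳ-≤ᵥ u ps

+ᵥ-cancelˡ-≤ᵥ : ∀ (u : Vec ℕ k) {v w} → (u +ᵥ v) ≤ᵥ (u +ᵥ w) → v ≤ᵥ w
+ᵥ-cancelˡ-≤ᵥ [] {[]} {[]} [] = []
+ᵥ-cancelˡ-≤ᵥ (x ∷ u) {_ ∷ _} {_ ∷ _} (p ∷ ps) = ℕₚ.+-cancelˡ-≤ x _ _ p ∷ +ᵥ-cancelˡ-≤ᵥ u ps

+ᵥ-cancelˡ-≡ : ∀ (u : Vec ℕ k) {v w} → u +ᵥ v ≡ u +ᵥ w → v ≡ w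
+ᵥ-cancelˡ-≡ u eq = ≤ᵥ-antisym (+ᵥ-cancelˡ-≤ᵥ u (≤ᵥ-reflexive eq)) (+ᵥ-cancelˡ-≤ᵥ u (≤ᵥ-reflexive (sym eq)))

sum-mono : ∀ {u v : Vec ℕ k} → u ≤ᵥ v → Vec.sum u ℕ.≤ Vec.sum v
sum-mono [] = z≤n
sum-mono (p ∷ ps) = ℕₚ.+-mono-≤ p (sum-mono ps)

sum-strictMono : ∀ {u v : Vec ℕ k} → u ≤ᵥ v → u ≢ v → Vec.sum u ℕ.< Vec.sum v
sum-strictMono {u = []} {[]} [] u≢v = contradiction refl u≢v
sum-strictMono {u = x ∷ u} (p ∷ ps) u≢v with ℕₚ.m≤n⇒m<n∨m≡n p
... | inj₁ x<y = ℕₚ.+-mono-<-≤ x<y (sum-mono ps)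
... | inj₂ refl = ℕₚ.+-monoʳ-< x (sum-strictMono ps (u≢v ∘ cong (x ∷_)))

any-≤ᵥ? : ∀ {P : Vec ℕ k → Set} → Decidable P → ∀ w → Dec (∃[ v ] (v ≤ᵥ w × P v))
any-≤ᵥ? {zero} P? [] = map′ (λ p → [] , [] , p) (λ { ([] , [] , p) → p }) (P? [])
any-≤ᵥ? {suc k} P? (x ∷ w) =
  map′ (λ { (y , s≤s y≤x , v , v≤w , p) → y ∷ v , y≤x ∷ v≤w , p })
       (λ { (y ∷ v , y≤x ∷ v≤w , p) → y , s≤s y≤x , v , v≤w , p })
       (ℕₚ.anyUpTo? (λ y → any-≤ᵥ? (P? ∘ (y ∷_)) w) (suc x))

Min-below : ∀ {P : Vec ℕ k → Set} → Decidable P → ∀ {w} → P w → ∃[ m ] (Min P m × m ≤ᵥ w)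
Min-below {P = P} P? {w} Pw = go w Pw (<-wellFounded (Vec.sum w))
  where
  go : ∀ w → P w → Acc ℕ._<_ (Vec.sum w) → ∃[ m ] (Min P m × m ≤ᵥ w)
  go w Pw (acc rec) with any-≤ᵥ? (λ v → P? v ×-dec ¬? (Vecₚ.≡-dec ℕₚ._≟_ v w)) w
  ... | yes (v , v≤w , Pv , v≢w) =
    let m , minm , m≤v = go v Pv (rec (sum-strictMono v≤w v≢w)) in m , minm , ≤ᵥ-trans m≤v v≤w
  ... | no ¬below = w , (Pw , λ v Pv v≤w →
    decidable-stable (Vecₚ.≡-dec ℕₚ._≟_ v w) (λ v≢w → ¬below (v , v≤w , Pv , v≢w))) , ≤ᵥ-refl

Min-sandwich : ∀ {P Q : Vec ℕ k → Set} → Decidable P →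
  (∀ {v} → Q v → P v) → (∀ {v} → Min P v → Q v) → ∀ v → Min Q v ⇔ Min P v
Min-sandwich {P = P} {Q} P? Q⊆P minP⊆Q v = mk⇔ minQ⇒minP minP⇒minQ
  where
  minQ⇒minP : Min Q v → Min P v
  minQ⇒minP (Qv , minQ) = Q⊆P Qv , λ w Pw w≤v →
    let m , minPm , m≤w = Min-below P? Pw
        m≡v = minQ m (minP⊆Q minPm) (≤ᵥ-trans m≤w w≤v)
    in ≤ᵥ-antisym w≤v (subst (_≤ᵥ w) m≡v m≤w)
  minP⇒minQ : Min P v → Min Q v
  minP⇒minQ minPv@(_ , minP) = minP⊆Q minPv , λ w Qw w≤v → minP w (Q⊆P Qw) w≤v

-- Points of 𝒟≥0(f)

∀-subset? : ∀ {P : Subset k → Set} → Decidable P → Dec (∀ T → P T)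
∀-subset? P? = map′ (λ ¬∃¬P T → decidable-stable (P? T) (λ ¬PT → ¬∃¬P (T , ¬PT)))
                    (λ ∀P (T , ¬PT) → ¬PT (∀P T))
                    (¬? (anySubset? (¬? ∘ P?)))

Dge0? : ∀ (f : MPoly k) → Decidable (Dge0 f)
Dge0? f d = All.all? (1 ℕₚ.≤?_) d
        ×-dec ∀-subset? (λ T → nonempty? T →-dec (+ 0 ℤₚ.<? shiftCoeff f d T))
        ×-dec (+ 0 ℤₚ.≤? eval f d)

*-nonNeg : ∀ {i j} → + 0 ≤ i → + 0 ≤ j → + 0 ≤ i * j
*-nonNeg {+ m} {+ n} _ _ = subst (+ 0 ≤_) (ℤₚ.pos-* m n) (+≤+ z≤n)

*-pos : ∀ {i j} → + 0 < i → + 0 < j → + 0 < i * j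
*-pos {+ zero} (+<+ ())
*-pos {+ suc m} {+ zero} _ (+<+ ())
*-pos {+ suc m} {+ suc n} _ _ = subst (+ 0 <_) (ℤₚ.pos-* (suc m) (suc n)) (+<+ (s≤s z≤n))

monoVal-nonNeg : ∀ (T : Subset k) e → + 0 ≤ monoVal T e
monoVal-nonNeg [] [] = +≤+ z≤n
monoVal-nonNeg (true ∷ T) (x ∷ e) = *-nonNeg {+ x} (+≤+ z≤n) (monoVal-nonNeg T e)
monoVal-nonNeg (false ∷ T) (x ∷ e) = monoVal-nonNeg T e

monoVal-⁅⁆ : ∀ (i : Fin k) e → monoVal ⁅ i ⁆ e ≡ + lookup e i
monoVal-⁅⁆ zero (x ∷ e) = trans (cong (+ x *_) (monoVal-⊥ e)) (ℤₚ.*-identityʳ (+ x))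
  where
  monoVal-⊥ : ∀ {k} (e : Vec ℕ k) → monoVal ⊥ e ≡ + 1
  monoVal-⊥ [] = refl
  monoVal-⊥ (_ ∷ e) = monoVal-⊥ e
monoVal-⁅⁆ (suc i) (x ∷ e) = monoVal-⁅⁆ i e

linearCoeff-pos : ∀ {f : MPoly k} {d} → NonConstPos f d → ∀ i → + 0 < shiftCoeff f d ⁅ i ⁆
linearCoeff-pos pos i = pos ⁅ i ⁆ (i , x∈⁅x⁆ i)

shiftCoeff-nonNeg : ∀ {f : MPoly k} {d} → Dge0 f d → ∀ T → + 0 ≤ shiftCoeff f d T
shiftCoeff-nonNeg {f = f} {d} (_ , pos , f[d]≥0) T with nonempty? T
... | yes T≠∅ = ℤₚ.<⇒≤ (pos T T≠∅)
... | no T≡∅ = subst (λ S → + 0 ≤ shiftCoeff f d S) (sym (Empty-unique T≡∅))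
                     (subst (+ 0 ≤_) (eval≡shiftCoeff-⊥ f d) f[d]≥0)

eval-pos-above : ∀ {f : MPoly k} {w v} → Dge0 f w → w ≤ᵥ v → w ≢ v → + 0 < eval f v
eval-pos-above {k} {f} {w} {v} w∈D w≤v w≢v = subst (λ u → + 0 < eval f u) (u+ᵥ[v∸ᵥu]≡v w≤v)
  (subst (+ 0 <_) (sym (eval-+ᵥ f w e))
    (∑-pos term-nonNeg (allSubsets k) (∈-allSubsets ⁅ i ⁆)
      (*-pos (linearCoeff-pos {f = f} (proj₁ (proj₂ w∈D)) i)
             (subst (+ 0 <_) (sym (trans (monoVal-⁅⁆ i e) (cong +_ (Vecₚ.lookup-zipWith ℕ._∸_ i v w))))
                    (+<+ (ℕₚ.m<n⇒0<n∸m wᵢ<vᵢ))))))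
  where
  e : Vec ℕ k
  e = v ∸ᵥ w
  i : Fin k
  i = proj₁ (≤ᵥ∧≢⇒∃< w≤v w≢v)
  wᵢ<vᵢ : lookup w i ℕ.< lookup v i
  wᵢ<vᵢ = proj₂ (≤ᵥ∧≢⇒∃< w≤v w≢v)
  term-nonNeg : ∀ T → + 0 ≤ shiftCoeff f w T * monoVal T e
  term-nonNeg T = *-nonNeg (shiftCoeff-nonNeg {f = f} w∈D T) (monoVal-nonNeg T e)

Dset⇒Min-Dge0 : ∀ {f : MPoly k} {v} → Dset f v → Min (Dge0 f) v
Dset⇒Min-Dge0 {f = f} {v} (v>0 , pos , f[v]≡0) = (v>0 , pos , ℤₚ.≤-reflexive (sym f[v]≡0)) , minimal
  where
  minimal : ∀ w → Dge0 f w → w ≤ᵥ v → w ≡ v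
  minimal w w∈D w≤v = decidable-stable (Vecₚ.≡-dec ℕₚ._≟_ w v)
    (λ w≢v → ℤₚ.<-irrefl (sym f[v]≡0) (eval-pos-above {f = f} w∈D w≤v w≢v))

Dset⇔Min-Dge0∧root : ∀ (f : MPoly k) v → Dset f v ⇔ (Min (Dge0 f) v × eval f v ≡ + 0)
Dset⇔Min-Dge0∧root f v = mk⇔ (λ v∈D → Dset⇒Min-Dge0 {f = f} v∈D , proj₂ (proj₂ v∈D))
                             (λ (((v>0 , pos , _) , _) , f[v]≡0) → v>0 , pos , f[v]≡0)

-- Partial derivatives

insertAt-nonempty : ∀ (T : Subset k) s → Nonempty (insertAt T s true)
insertAt-nonempty T s = s , Vecₚ.lookup⇒[]= s (insertAt T s true) (Vecₚ.insertAt-lookup T s true)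

insertAt-⊤ : ∀ (s : Fin (suc k)) → insertAt ⊤ s true ≡ ⊤
insertAt-⊤ zero = refl
insertAt-⊤ {suc k} (suc s) = cong (true ∷_) (insertAt-⊤ s)

Positive-insertAt⁻ : ∀ (r : Vec ℕ k) s x → Positive (insertAt r s x) → Positive r
Positive-insertAt⁻ r zero x (_ All.∷ r>0) = r>0
Positive-insertAt⁻ (y ∷ r) (suc s) x (y>0 All.∷ r>0) = y>0 All.∷ Positive-insertAt⁻ r s x r>0

insertAt-mono : ∀ {u v : Vec ℕ k} s {x y} → u ≤ᵥ v → x ℕ.≤ y → insertAt u s x ≤ᵥ insertAt v s y
insertAt-mono zero u≤v x≤y = x≤y ∷ u≤v
insertAt-mono (suc s) (p ∷ ps) x≤y = p ∷ insertAt-mono s ps x≤y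

-- The constant term of (∂ₛf)_r is the coefficient of x_s in f at insertAt r s x, which is positive.
Dge0-∂ : ∀ (f : MPoly (suc k)) s {r x} → Dge0 f (insertAt r s x) → Dge0 (∂ s f) r
Dge0-∂ f s {r} {x} (d>0 , pos , _) =
  Positive-insertAt⁻ r s x d>0 ,
  (λ T _ → subst (+ 0 <_) (shiftCoeff-∂ s f r x T) (pos (insertAt T s true) (insertAt-nonempty T s))) ,
  ℤₚ.<⇒≤ (subst (+ 0 <_) (trans (shiftCoeff-∂ s f r x ⊥) (sym (eval≡shiftCoeff-⊥ (∂ s f) r)))
                         (pos (insertAt ⊥ s true) (insertAt-nonempty ⊥ s)))

∂-Min-below : ∀ (f : MPoly (suc k)) s {m} → Dge0 f m → ∃[ d̃ ] (Min (Dge0 (∂ s f)) d̃ × ins1 s d̃ ≤ᵥ m)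
∂-Min-below f s {m} m∈D =
  let d̃ , d̃-min , d̃≤m₋ₛ = Min-below (Dge0? (∂ s f))
                             (Dge0-∂ f s (subst (Dge0 f) (sym (Vecₚ.insertAt-removeAt m s)) m∈D))
  in d̃ , d̃-min , subst (ins1 s d̃ ≤ᵥ_) (Vecₚ.insertAt-removeAt m s)
                       (insertAt-mono s d̃≤m₋ₛ (Allₚ.lookup⁺ (proj₁ m∈D) s))

-- One step of the algorithm

foldr-⊔-least : ∀ (h : A → ℕ) {b} → (∀ x → h x ℕ.≤ b) → ∀ xs → List.foldr _⊔_ 0 (List.map h xs) ℕ.≤ b
foldr-⊔-least h h≤b [] = z≤n
foldr-⊔-least h h≤b (x ∷ xs) = ℕₚ.⊔-lub (h≤b x) (foldr-⊔-least h h≤b xs)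

foldr-⊔-upper : ∀ (h : A → ℕ) {x} xs → x ∈ₗ xs → h x ℕ.≤ List.foldr _⊔_ 0 (List.map h xs)
foldr-⊔-upper h (y ∷ xs) (here refl) = ℕₚ.m≤m⊔n (h y) _
foldr-⊔-upper h (y ∷ xs) (there x∈xs) = ℕₚ.≤-trans (foldr-⊔-upper h xs x∈xs) (ℕₚ.m≤n⊔m (h y) _)

supᵥ-least : ∀ {m} (δ : Fin m → Vec ℕ k) {v} → (∀ s → δ s ≤ᵥ v) → supᵥ δ ≤ᵥ v
supᵥ-least {m = m} δ δ≤v = lookup⁻¹-≤ᵥ λ i →
  subst (ℕ._≤ _) (sym (Vecₚ.lookup∘tabulate _ i))
        (foldr-⊔-least (λ s → lookup (δ s) i) (λ s → Pointwise.lookup (δ≤v s) i) (List.allFin m))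

supᵥ-upper : ∀ {m} (δ : Fin m → Vec ℕ k) s → δ s ≤ᵥ supᵥ δ
supᵥ-upper {m = m} δ s = lookup⁻¹-≤ᵥ λ i →
  subst (_ ℕ.≤_) (sym (Vecₚ.lookup∘tabulate _ i))
        (foldr-⊔-upper (λ s → lookup (δ s) i) (List.allFin m) (∈-allFin s))

supᵥ-positive : ∀ (δ : Fin k → Vec ℕ k) → (∀ s → 1 ℕ.≤ lookup (δ s) s) → Positive (supᵥ δ)
supᵥ-positive δ δₛₛ≥1 = Allₚ.lookup⁻ λ s → ℕₚ.≤-trans (δₛₛ≥1 s) (Pointwise.lookup (supᵥ-upper δ s) s)

bump-inflationary : ∀ t (d : Vec ℕ k) → d ≤ᵥ bump t d
bump-inflationary t d = lookup⁻¹-≤ᵥ λ i → case (i Finₚ.≟ t)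
  where
  case : ∀ {i} → Dec (i ≡ t) → lookup d i ℕ.≤ lookup (bump t d) i
  case {i} (yes refl) = ℕₚ.≤-trans (ℕₚ.n≤1+n _) (ℕₚ.≤-reflexive (sym (Vecₚ.lookup∘updateAt i d)))
  case {i} (no i≢t) = ℕₚ.≤-reflexive (sym (Vecₚ.lookup∘updateAt′ i t i≢t d))

bump-least : ∀ t {d m : Vec ℕ k} → d ≤ᵥ m → lookup d t ℕ.< lookup m t → bump t d ≤ᵥ m
bump-least t {d} {m} d≤m dₜ<mₜ = lookup⁻¹-≤ᵥ λ i → case (i Finₚ.≟ t)
  where
  case : ∀ {i} → Dec (i ≡ t) → lookup (bump t d) i ℕ.≤ lookup m i
  case {i} (yes refl) = subst (ℕ._≤ _) (sym (Vecₚ.lookup∘updateAt i d)) dₜ<mₜ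
  case {i} (no i≢t) = subst (ℕ._≤ _) (sym (Vecₚ.lookup∘updateAt′ i t i≢t d)) (Pointwise.lookup d≤m i)

module _ (f : MPoly k) where
  open Step f

  GoodShift⇒Dge0 : ∀ {d e} → Positive d → GoodShift d e → Dge0 f (d +ᵥ e)
  GoodShift⇒Dge0 {d} {e} d>0 (pos , ≥0) =
    Positive-mono (u≤ᵥu+ᵥv d e) d>0 , pos , subst (+ 0 ≤_) (sym (eval≡shiftCoeff-⊥ f (d +ᵥ e))) ≥0

  Dge0⇒GoodShift : ∀ {d e} → Dge0 f (d +ᵥ e) → GoodShift d e
  Dge0⇒GoodShift {d} {e} (_ , pos , f≥0) = pos , subst (+ 0 ≤_) (eval≡shiftCoeff-⊥ f (d +ᵥ e)) f≥0

  Added-sound : ∀ {d v} → Positive d → Added d v → Dge0 f v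
  Added-sound {d} d>0 (e , (good , _) , refl) = subst (Dge0 f) (+ᵥ-comm d e) (GoodShift⇒Dge0 d>0 good)

  Added-complete : ∀ {d m} → Positive d → d ≤ᵥ m → Min (Dge0 f) m → Added d m
  Added-complete {d} {m} d>0 d≤m (m∈D , minimal) =
    m ∸ᵥ d , (Dge0⇒GoodShift (subst (Dge0 f) (sym d+e≡m) m∈D) , least) , trans (sym d+e≡m) (+ᵥ-comm d (m ∸ᵥ d))
    where
    d+e≡m : d +ᵥ (m ∸ᵥ d) ≡ m
    d+e≡m = u+ᵥ[v∸ᵥu]≡v d≤m
    least : ∀ e → GoodShift d e → e ≤ᵥ (m ∸ᵥ d) → e ≡ m ∸ᵥ d
    least e good e≤m∸d = +ᵥ-cancelˡ-≡ d (trans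
      (minimal (d +ᵥ e) (GoodShift⇒Dge0 d>0 good) (subst ((d +ᵥ e) ≤ᵥ_) d+e≡m (+ᵥ-monoʳ-≤ᵥ d e≤m∸d)))
      (sym d+e≡m))

  Added-complete-bump : ∀ {d m} t → Positive d → d ≤ᵥ m → lookup d t ℕ.< lookup m t →
                        Min (Dge0 f) m → Added (bump t d) m
  Added-complete-bump {d} t d>0 d≤m dₜ<mₜ =
    Added-complete (Positive-mono (bump-inflationary t d) d>0) (bump-least t d≤m dₜ<mₜ)

  -- The coefficient of x_s in f_d does not involve d_s; as it is positive at m but zero at d ≤ m,
  -- m must exceed d in a coordinate other than s.
  Zero-escape : ∀ {d m s} → Zero d s → d ≤ᵥ m → NonConstPos f m →
                ∃[ t ] (t ≢ s × lookup d t ℕ.< lookup m t)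
  Zero-escape {d} {m} {s} zero-s d≤m pos
    with Finₚ.any? (λ t → ¬? (t Finₚ.≟ s) ×-dec (lookup d t ℕₚ.<? lookup m t))
  ... | yes escape = escape
  ... | no ¬escape =
    ⊥-elim (ℤₚ.<-irrefl (sym (trans (shiftCoeff-cong f ⁅ s ⁆ agree) zero-s)) (linearCoeff-pos {f = f} pos s))
    where
    agree : ∀ i → lookup ⁅ s ⁆ i ≡ false → lookup m i ≡ lookup d i
    agree i i∉s = ℕₚ.≤-antisym (ℕₚ.≮⇒≥ (λ dᵢ<mᵢ → ¬escape (i , i≢s , dᵢ<mᵢ))) (Pointwise.lookup d≤m i)
      where
      i≢s : i ≢ s
      i≢s refl with trans (sym (Vecₚ.[]=⇒lookup (x∈⁅x⁆ i))) i∉s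
      ... | ()

  Zero? : ∀ d s → Dec (Zero d s)
  Zero? d s = shiftCoeff f d ⁅ s ⁆ ℤₚ.≟ + 0

  AddedFor-sound : ∀ δ {v} → Positive (supᵥ δ) → AddedFor δ v → Dge0 f v
  AddedFor-sound δ d>0 (inj₁ (_ , added)) = Added-sound d>0 added
  AddedFor-sound δ d>0 (inj₂ (inj₁ (_ , t , _ , added))) =
    Added-sound (Positive-mono (bump-inflationary t (supᵥ δ)) d>0) added
  AddedFor-sound δ d>0 (inj₂ (inj₂ (s₁ , s₂ , _ , _ , _ , added))) =
    Added-sound (Positive-mono (≤ᵥ-trans (bump-inflationary s₁ _) (bump-inflationary s₂ _)) d>0) added

  AddedFor-complete : ∀ δ {m} → Positive (supᵥ δ) → supᵥ δ ≤ᵥ m → Min (Dge0 f) m → AddedFor δ m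
  AddedFor-complete δ d>0 d≤m m-min@((_ , pos , _) , _) with Finₚ.any? (Zero? (supᵥ δ))
  ... | no ¬zero = inj₁ ((λ s zero-s → ¬zero (s , zero-s)) , Added-complete d>0 d≤m m-min)
  ... | yes (s , zero-s) with Zero-escape zero-s d≤m pos
  ...   | t₁ , _ , <₁ with Zero? (supᵥ δ) t₁
  ...     | no nonzero₁ =
              inj₂ (inj₁ ((s , zero-s) , t₁ , nonzero₁ , Added-complete-bump t₁ d>0 d≤m <₁ m-min))
  ...     | yes zero₁ with Zero-escape zero₁ d≤m pos
  ...       | t₂ , t₂≢t₁ , <₂ with Zero? (supᵥ δ) t₂
  ...         | no nonzero₂ =
                  inj₂ (inj₁ ((s , zero-s) , t₂ , nonzero₂ , Added-complete-bump t₂ d>0 d≤m <₂ m-min))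
  ...         | yes zero₂ = inj₂ (inj₂ (t₁ , t₂ , t₂≢t₁ ∘ sym , zero₁ , zero₂ ,
                  Added-complete-bump t₂ (Positive-mono (bump-inflationary t₁ _) d>0) (bump-least t₁ d≤m <₁)
                    (subst (ℕ._< _) (sym (Vecₚ.lookup∘updateAt′ t₂ t₁ t₂≢t₁ (supᵥ δ))) <₂) m-min))

-- Two variables

-- For q = k + 1, ceilDiv computes ⌈m / q⌉ as ⌊(m + k) / q⌋ and ⌈−m / q⌉ as −⌊m / q⌋.
*-ceilDiv-≥ : ∀ p q → + 0 < q → p ≤ q * ceilDiv p q
*-ceilDiv-≥ (+ m) +[1+ k ] _ = subst (+ m ≤_) (ℤₚ.pos-* (suc k) Q) (+≤+ m≤[1+k]*Q)
  where
  Q : ℕ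
  Q = (m ℕ.+ k) / suc k
  m≤[1+k]*Q : m ℕ.≤ suc k ℕ.* Q
  m≤[1+k]*Q = ℕₚ.+-cancelʳ-≤ k m (suc k ℕ.* Q) (begin
    m ℕ.+ k                             ≡⟨ m≡m%n+[m/n]*n (m ℕ.+ k) (suc k) ⟩
    (m ℕ.+ k) % suc k ℕ.+ Q ℕ.* suc k  ≤⟨ ℕₚ.+-monoˡ-≤ _ (ℕₚ.≤-pred (m%n<n (m ℕ.+ k) (suc k))) ⟩
    k ℕ.+ Q ℕ.* suc k                   ≡⟨ ℕₚ.+-comm k _ ⟩
    Q ℕ.* suc k ℕ.+ k                   ≡⟨ cong (ℕ._+ k) (ℕₚ.*-comm Q (suc k)) ⟩
    suc k ℕ.* Q ℕ.+ k                   ∎)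
    where open ℕₚ.≤-Reasoning
*-ceilDiv-≥ -[1+ m ] +[1+ k ] _ =
  subst (-[1+ m ] ≤_) (trans (cong -_ (ℤₚ.pos-* (suc k) Q)) (ℤₚ.neg-distribʳ-* +[1+ k ] (+ Q)))
        (ℤₚ.neg-mono-≤ (+≤+ (ℕₚ.≤-trans (ℕₚ.≤-reflexive (ℕₚ.*-comm (suc k) Q)) (m/n*n≤m (suc m) (suc k)))))
  where
  Q : ℕ
  Q = suc m / suc k
*-ceilDiv-≥ p (+ zero) (+<+ ())

ceilDiv-least : ∀ p q z → + 0 < q → p ≤ q * z → ceilDiv p q ≤ z
ceilDiv-least (+ m) +[1+ k ] (+ n) _ m≤qn =
  +≤+ (ℕₚ.≤-pred (m<n*o⇒m/o<n {m ℕ.+ k} {suc n} {suc k} m+k<[1+n][1+k]))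
  where
  m≤[1+k]n : m ℕ.≤ suc k ℕ.* n
  m≤[1+k]n = ℤₚ.drop‿+≤+ (subst (+ m ≤_) (sym (ℤₚ.pos-* (suc k) n)) m≤qn)
  m+k<[1+n][1+k] : m ℕ.+ k ℕ.< suc n ℕ.* suc k
  m+k<[1+n][1+k] = subst (m ℕ.+ k ℕ.<_) (ℕₚ.+-comm (n ℕ.* suc k) (suc k))
    (ℕₚ.+-mono-≤-< (subst (m ℕ.≤_) (ℕₚ.*-comm (suc k) n) m≤[1+k]n) (ℕₚ.n<1+n k))
ceilDiv-least p (+ zero) z (+<+ ())
ceilDiv-least (+ m) +[1+ k ] -[1+ n ] _ ()
ceilDiv-least -[1+ m ] +[1+ k ] (+ n) _ _ = ℤₚ.neg-≤-pos
ceilDiv-least -[1+ m ] +[1+ k ] -[1+ n ] _ -m≤-qn = ℤₚ.neg-mono-≤ (+≤+ 1+n≤Q)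
  where
  [1+k][1+n]≤1+m : suc k ℕ.* suc n ℕ.≤ suc m
  [1+k][1+n]≤1+m = ℤₚ.drop‿+≤+ (subst₂ _≤_ (trans (ℤₚ.neg-involutive _) (sym (ℤₚ.pos-* (suc k) (suc n)))) refl
    (ℤₚ.neg-mono-≤ (subst (-[1+ m ] ≤_) (sym (ℤₚ.neg-distribʳ-* +[1+ k ] (+ suc n))) -m≤-qn)))
  1+n≤Q : suc n ℕ.≤ suc m / suc k
  1+n≤Q = subst (ℕ._≤ suc m / suc k) (m*n/n≡m (suc n) (suc k))
    (/-monoˡ-≤ (suc k) (subst (ℕ._≤ suc m) (ℕₚ.*-comm (suc k) (suc n)) [1+k][1+n]≤1+m))

ceilDiv-≤⇔ : ∀ p q z → + 0 < q → ceilDiv p q ≤ z ⇔ p ≤ q * z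
ceilDiv-≤⇔ p q@(+[1+ k ]) z q>0 = mk⇔
  (λ ceil≤z → ℤₚ.≤-trans (*-ceilDiv-≥ p q q>0) (ℤₚ.*-monoˡ-≤-nonNeg q ceil≤z))
  (ceilDiv-least p q z q>0)
ceilDiv-≤⇔ p (+ zero) z (+<+ ())

≤-resp-⇔ : ∀ {i i′ j j′} → i ≡ i′ → j ≡ j′ → i ≤ j ⇔ i′ ≤ j′
≤-resp-⇔ refl refl = ⇔.refl

+-monoˡ-≤⇔ : ∀ r {i z} → i ≤ z ⇔ i + r ≤ z + r
+-monoˡ-≤⇔ r {i} {z} = mk⇔ (ℤₚ.+-monoˡ-≤ r)
  (λ i+r≤z+r → subst₂ _≤_ ([i+r]-r≡i i r) ([i+r]-r≡i z r) (ℤₚ.+-monoˡ-≤ (- r) i+r≤z+r))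
  where
  [i+r]-r≡i : ∀ i r → (i + r) - r ≡ i
  [i+r]-r≡i = solve-∀

ceilDiv-neg-≤⇔ : ∀ r q z → + 0 < q → ceilDiv (- r) q ≤ z ⇔ + 0 ≤ q * z + r
ceilDiv-neg-≤⇔ r q z q>0 =
  ⇔.trans (ceilDiv-≤⇔ (- r) q z q>0) (⇔.trans (+-monoˡ-≤⇔ r) (≤-resp-⇔ (ℤₚ.+-inverseˡ r) refl))

ceilDiv-1-≤⇔ : ∀ r q z → + 0 < q → ceilDiv (+ 1 - r) q ≤ z ⇔ + 0 < q * z + r
ceilDiv-1-≤⇔ r q z q>0 =
  ⇔.trans (ceilDiv-≤⇔ (+ 1 - r) q z q>0) (⇔.trans (+-monoˡ-≤⇔ r) (⇔.trans (≤-resp-⇔ ([1-r]+r≡1 r) refl)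
    (mk⇔ ℤₚ.suc[i]≤j⇒i<j ℤₚ.i<j⇒suc[i]≤j)))
  where
  [1-r]+r≡1 : ∀ r → (+ 1 - r) + r ≡ + 1
  [1-r]+r≡1 = solve-∀

+≤+⇔ : ∀ {m n} → + m ≤ + n ⇔ m ℕ.≤ n
+≤+⇔ = mk⇔ ℤₚ.drop‿+≤+ +≤+

⊔-≤⇔ : ∀ i j {z} → i ℤ.⊔ j ≤ z ⇔ (i ≤ z × j ≤ z)
⊔-≤⇔ i j = mk⇔ (λ i⊔j≤z → ℤₚ.i⊔j≤k⇒i≤k i j i⊔j≤z , ℤₚ.i⊔j≤k⇒j≤k i j i⊔j≤z) (λ (i≤z , j≤z) → ℤₚ.⊔-lub i≤z j≤z)

module TwoVariables (f : MPoly 2) (a>0 : + 0 < f (true ∷ true ∷ [])) where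
  open Base f
  open Equivalence using (to; from)

  value : ℤ → ℤ → ℤ
  value x y = a * x * y + b₁ * x + b₂ * y + c

  -- Each normalise identity starts from the unreduced shape of shiftCoeff on a vector of length 2.
  shiftCoeff-x₁x₂ : ∀ x y → shiftCoeff f (x ∷ y ∷ []) (true ∷ true ∷ []) ≡ a
  shiftCoeff-x₁x₂ x y = normalise a b₁ b₂ c
    where
    normalise : ∀ a b₁ b₂ c → a * + 1 + (b₁ * + 0 + (b₂ * + 0 + (c * + 0 + + 0))) ≡ a
    normalise = solve-∀

  shiftCoeff-x₁ : ∀ x y → shiftCoeff f (x ∷ y ∷ []) (true ∷ false ∷ []) ≡ a * + y + b₁
  shiftCoeff-x₁ x y = normalise a b₁ b₂ c (+ y)
    where
    normalise : ∀ a b₁ b₂ c y → a * (y * + 1) + (b₁ * + 1 + (b₂ * + 0 + (c * + 0 + + 0))) ≡ a * y + b₁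
    normalise = solve-∀

  shiftCoeff-x₂ : ∀ x y → shiftCoeff f (x ∷ y ∷ []) (false ∷ true ∷ []) ≡ a * + x + b₂
  shiftCoeff-x₂ x y = normalise a b₁ b₂ c (+ x)
    where
    normalise : ∀ a b₁ b₂ c x →
      a * (x * + 1) + (b₁ * (x * + 0) + (b₂ * + 1 + (c * + 0 + + 0))) ≡ a * x + b₂
    normalise = solve-∀

  eval≡value : ∀ x y → eval f (x ∷ y ∷ []) ≡ value (+ x) (+ y)
  eval≡value x y = normalise a b₁ b₂ c (+ x) (+ y)
    where
    normalise : ∀ a b₁ b₂ c x y →
      a * (x * (y * + 1)) + (b₁ * (x * + 1) + (b₂ * (y * + 1) + (c * + 1 + + 0))) ≡ a * x * y + b₁ * x + b₂ * y + c
    normalise = solve-∀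

  value-by-row : ∀ x y → (a * x + b₂) * y + (c + b₁ * x) ≡ value x y
  value-by-row x y = identity a b₁ b₂ c x y
    where
    identity : ∀ a b₁ b₂ c x y → (a * x + b₂) * y + (c + b₁ * x) ≡ a * x * y + b₁ * x + b₂ * y + c
    identity = solve-∀

  value-by-column : ∀ x y → (a * y + b₁) * x + (c + b₂ * y) ≡ value x y
  value-by-column x y = identity a b₁ b₂ c x y
    where
    identity : ∀ a b₁ b₂ c x y → (a * y + b₁) * x + (c + b₂ * y) ≡ a * x * y + b₁ * x + b₂ * y + c
    identity = solve-∀

  d₁⁺-≤⇔ : ∀ x → d₁⁺ ≤ + x ⇔ (1 ℕ.≤ x × + 0 < a * + x + b₂)
  d₁⁺-≤⇔ x = ⇔.trans (⊔-≤⇔ (+ 1) _) (+≤+⇔ ×-⇔ ceilDiv-1-≤⇔ b₂ a (+ x) a>0)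

  d₂⁺-≤⇔ : ∀ y → d₂⁺ ≤ + y ⇔ (1 ℕ.≤ y × + 0 < a * + y + b₁)
  d₂⁺-≤⇔ y = ⇔.trans (⊔-≤⇔ (+ 1) _) (+≤+⇔ ×-⇔ ceilDiv-1-≤⇔ b₁ a (+ y) a>0)

  second-≤⇔ : ∀ x y → + 0 < a * + x + b₂ → second x ≤ y ⇔ (d₂⁺ ≤ y × + 0 ≤ value (+ x) y)
  second-≤⇔ x y q>0 = ⇔.trans (⊔-≤⇔ d₂⁺ _)
    (⇔.refl ×-⇔ ⇔.trans (ceilDiv-neg-≤⇔ (c + b₁ * + x) _ y q>0) (≤-resp-⇔ refl (value-by-row (+ x) y)))

  NonConstPos⇔ : ∀ x y → NonConstPos f (x ∷ y ∷ []) ⇔ (+ 0 < a * + y + b₁ × + 0 < a * + x + b₂)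
  NonConstPos⇔ x y = mk⇔
    (λ pos → subst (+ 0 <_) (shiftCoeff-x₁ x y) (pos (true ∷ false ∷ []) (zero , Vec.here)) ,
             subst (+ 0 <_) (shiftCoeff-x₂ x y) (pos (false ∷ true ∷ []) (suc zero , Vec.there Vec.here)))
    (λ (pos₁ , pos₂) → λ
      { (true ∷ true ∷ []) _ → subst (+ 0 <_) (sym (shiftCoeff-x₁x₂ x y)) a>0
      ; (true ∷ false ∷ []) _ → subst (+ 0 <_) (sym (shiftCoeff-x₁ x y)) pos₁
      ; (false ∷ true ∷ []) _ → subst (+ 0 <_) (sym (shiftCoeff-x₂ x y)) pos₂
      ; (false ∷ false ∷ []) (zero , ())
      ; (false ∷ false ∷ []) (suc zero , Vec.there ()) })

  Dge0⇔ : ∀ x y → Dge0 f (x ∷ y ∷ []) ⇔ (d₁⁺ ≤ + x × second x ≤ + y)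
  Dge0⇔ x y = mk⇔
    (λ { (x≥1 All.∷ y≥1 All.∷ All.[] , pos , f≥0) →
      let pos₁ , pos₂ = to (NonConstPos⇔ x y) pos
      in from (d₁⁺-≤⇔ x) (x≥1 , pos₂) ,
         from (second-≤⇔ x (+ y) pos₂) (from (d₂⁺-≤⇔ y) (y≥1 , pos₁) , subst (+ 0 ≤_) (eval≡value x y) f≥0) })
    (λ (d₁⁺≤x , second≤y) →
      let x≥1 , pos₂ = to (d₁⁺-≤⇔ x) d₁⁺≤x
          d₂⁺≤y , value≥0 = to (second-≤⇔ x (+ y) pos₂) second≤y
          y≥1 , pos₁ = to (d₂⁺-≤⇔ y) d₂⁺≤y
      in x≥1 All.∷ y≥1 All.∷ All.[] , from (NonConstPos⇔ x y) (pos₁ , pos₂) ,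
         subst (+ 0 ≤_) (sym (eval≡value x y)) value≥0)

  +∣d₂⁺∣≡d₂⁺ : + ∣ d₂⁺ ∣ ≡ d₂⁺
  +∣d₂⁺∣≡d₂⁺ = ℤₚ.0≤i⇒+∣i∣≡i (ℤₚ.≤-trans (+≤+ z≤n) (ℤₚ.i≤i⊔j (+ 1) _))

  +∣second∣≡second : ∀ x → + ∣ second x ∣ ≡ second x
  +∣second∣≡second x = ℤₚ.0≤i⇒+∣i∣≡i (ℤₚ.≤-trans (+≤+ z≤n) (ℤₚ.≤-trans (ℤₚ.i≤i⊔j (+ 1) _) (ℤₚ.i≤i⊔j d₂⁺ _)))

  +∣upper∣≡upper : + ∣ upper ∣ ≡ upper
  +∣upper∣≡upper = ℤₚ.0≤i⇒+∣i∣≡i (ℤₚ.≤-trans (+≤+ z≤n) (ℤₚ.≤-trans (ℤₚ.i≤i⊔j (+ 1) _) (ℤₚ.i≤i⊔j d₁⁺ _)))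

  graph∈Dge0 : ∀ x → d₁⁺ ≤ + x → Dge0 f (x ∷ ∣ second x ∣ ∷ [])
  graph∈Dge0 x d₁⁺≤x = from (Dge0⇔ x _) (d₁⁺≤x , ℤₚ.≤-reflexive (sym (+∣second∣≡second x)))

  -- This is why upper bounds the first entry of every minimal element.
  corner∈Dge0 : Dge0 f (∣ upper ∣ ∷ ∣ d₂⁺ ∣ ∷ [])
  corner∈Dge0 = from (Dge0⇔ ∣ upper ∣ ∣ d₂⁺ ∣) (d₁⁺≤U , from (second-≤⇔ ∣ upper ∣ (+ ∣ d₂⁺ ∣) pos₂)
    (ℤₚ.≤-reflexive (sym +∣d₂⁺∣≡d₂⁺) , subst (λ y → + 0 ≤ value (+ ∣ upper ∣) y) (sym +∣d₂⁺∣≡d₂⁺) value≥0))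
    where
    d₁⁺≤U : d₁⁺ ≤ + ∣ upper ∣
    d₁⁺≤U = subst (d₁⁺ ≤_) (sym +∣upper∣≡upper) (ℤₚ.i≤i⊔j d₁⁺ _)
    pos₂ : + 0 < a * + ∣ upper ∣ + b₂
    pos₂ = proj₂ (to (d₁⁺-≤⇔ ∣ upper ∣) d₁⁺≤U)
    pos₁ : + 0 < a * d₂⁺ + b₁
    pos₁ = subst (λ y → + 0 < a * y + b₁) +∣d₂⁺∣≡d₂⁺
                 (proj₂ (to (d₂⁺-≤⇔ ∣ d₂⁺ ∣) (ℤₚ.≤-reflexive (sym +∣d₂⁺∣≡d₂⁺))))
    value≥0 : + 0 ≤ value (+ ∣ upper ∣) d₂⁺
    value≥0 = subst (+ 0 ≤_) (value-by-column (+ ∣ upper ∣) d₂⁺)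
      (to (ceilDiv-neg-≤⇔ (c + b₂ * d₂⁺) _ (+ ∣ upper ∣) pos₁)
          (subst (ceilDiv (- (c + b₂ * d₂⁺)) (a * d₂⁺ + b₁) ≤_) (sym +∣upper∣≡upper) (ℤₚ.i≤j⊔i d₁⁺ _)))

  Cand⇒Dge0 : ∀ {v} → Cand v → Dge0 f v
  Cand⇒Dge0 (d , _ , d₁⁺≤d , _ , refl) = graph∈Dge0 d d₁⁺≤d

  Min⇒Cand : ∀ {v} → Min (Dge0 f) v → Cand v
  Min⇒Cand {x ∷ y ∷ []} (v∈D , minimal) =
    x , proj₁ (to (d₁⁺-≤⇔ x) d₁⁺≤x) , d₁⁺≤x , x≤upper , cong (λ z → x ∷ z ∷ []) y≡second
    where
    d₁⁺≤x : d₁⁺ ≤ + x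
    d₁⁺≤x = proj₁ (to (Dge0⇔ x y) v∈D)
    second≤y : second x ≤ + y
    second≤y = proj₂ (to (Dge0⇔ x y) v∈D)
    y≡second : y ≡ ∣ second x ∣
    y≡second = sym (cong (λ v → lookup v (suc zero)) (minimal _ (graph∈Dge0 x d₁⁺≤x)
      (ℕₚ.≤-refl ∷ ℤₚ.drop‿+≤+ (subst (_≤ + y) (sym (+∣second∣≡second x)) second≤y) ∷ [])))
    x≤upper : + x ≤ upper
    x≤upper = decidable-stable (+ x ℤₚ.≤? upper) λ x≰upper →
      let U<x = ℤₚ.drop‿+<+ (subst (_< + x) (sym +∣upper∣≡upper) (ℤₚ.≰⇒> x≰upper))
          D≤y = ℤₚ.drop‿+≤+ (subst (_≤ + y) (sym +∣d₂⁺∣≡d₂⁺)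
                  (ℤₚ.≤-trans (ℤₚ.i≤i⊔j d₂⁺ _) second≤y))
      in ℕₚ.<-irrefl (cong (λ v → lookup v zero) (minimal _ corner∈Dge0 (ℕₚ.<⇒≤ U<x ∷ D≤y ∷ []))) U<x

  baseMin-correct : ∀ v → baseMin f v ⇔ Min (Dge0 f) v
  baseMin-correct = Min-sandwich (Dge0? f) Cand⇒Dge0 Min⇒Cand

-- For Ã s = algMin n (∂ s f) this is the set whose minimal elements algMin (suc n) f consists of.
AddedFrom : ∀ (f : MPoly (suc k)) → (Fin (suc k) → Vec ℕ k → Set) → Vec ℕ (suc k) → Set
AddedFrom f Ã v = ∃[ δ ] ((∀ s → ∃[ d̃ ] (Ã s d̃ × δ s ≡ ins1 s d̃)) × Step.AddedFor f δ v)

ins1-diagonal : ∀ {s : Fin (suc k)} {v} {P : Vec ℕ k → Set} → ∃[ d̃ ] (P d̃ × v ≡ ins1 s d̃) → 1 ℕ.≤ lookup v s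
ins1-diagonal {s = s} (d̃ , _ , refl) = ℕₚ.≤-reflexive (sym (Vecₚ.insertAt-lookup d̃ s 1))

AddedFrom-sound : ∀ (f : MPoly (suc k)) Ã {v} → AddedFrom f Ã v → Dge0 f v
AddedFrom-sound f Ã (δ , δ∈A , added) = AddedFor-sound f δ (supᵥ-positive δ (ins1-diagonal ∘ δ∈A)) added

Min-Dge0⇒AddedFrom : ∀ (f : MPoly (suc k)) Ã → (∀ s {d̃} → Min (Dge0 (∂ s f)) d̃ → Ã s d̃) →
                     ∀ {m} → Min (Dge0 f) m → AddedFrom f Ã m
Min-Dge0⇒AddedFrom {k} f Ã min⊆Ã {m} m-min =
  δ , δ∈A , AddedFor-complete f δ (supᵥ-positive δ (ins1-diagonal ∘ δ∈A)) (supᵥ-least δ δ≤m) m-min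
  where
  pick : ∀ s → ∃[ d̃ ] (Min (Dge0 (∂ s f)) d̃ × ins1 s d̃ ≤ᵥ m)
  pick s = ∂-Min-below f s (proj₁ m-min)
  δ : Fin (suc k) → Vec ℕ (suc k)
  δ s = ins1 s (proj₁ (pick s))
  δ∈A : ∀ s → ∃[ d̃ ] (Ã s d̃ × δ s ≡ ins1 s d̃)
  δ∈A s = proj₁ (pick s) , min⊆Ã s (proj₁ (proj₂ (pick s))) , refl
  δ≤m : ∀ s → δ s ≤ᵥ m
  δ≤m s = proj₂ (proj₂ (pick s))

algMin-correct : ∀ n (f : MPoly (suc (suc n))) → + 0 < f ⊤ → ∀ v → algMin n f v ⇔ Min (Dge0 f) v
algMin-correct zero f a>0 = TwoVariables.baseMin-correct f a>0
algMin-correct (suc n) f a>0 =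
  Min-sandwich (Dge0? f) (AddedFrom-sound f _) (Min-Dge0⇒AddedFrom f _ λ s → Equivalence.from (IH s _))
  where
  IH : ∀ s v → algMin n (∂ s f) v ⇔ Min (Dge0 (∂ s f)) v
  IH s = algMin-correct n (∂ s f) (subst (λ T → + 0 < f T) (sym (insertAt-⊤ s)) a>0)

theorem2p8 : (n : ℕ) (f : MPoly (suc (suc n)))
    → Irreducible f
    → + 0 < f ⊤
    → (∀ v → algMin n f v ⇔ Min (Dge0 f) v)
      × (∀ v → algD n f v ⇔ Dset f v)
theorem2p8 n f _ a>0 =
  algMin-correct n f a>0 ,
  λ v → ⇔.trans (algMin-correct n f a>0 v ×-⇔ ⇔.refl) (⇔.sym (Dset⇔Min-Dge0∧root f v))
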